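{- Let $n\in\mathbb{N}$ and write $n=3^b m_1$ with $\gcd(3,m_1)=1$. Then $J_0^{1,3}(n)=1$ if $n=1$; $J_0^{1,3}(n)=-1$ if $n=3$; $J_0^{1,3}(n)=0$ if some prime $p\equiv 1\pmod 3$ divides $m_1$; $J_0^{1,3}(n)=0$ if $b\geq 2$; and $J_0^{1,3}(n)=(-1)^{\Omega(n)}2^{\omega(m_1)-1}$ otherwise.
   Context: $J_0^{1,3}(n)=\sum_{d\mid n,\ d\equiv 1\pmod 3}\mu(n/d)$, where $\mu$ is the Möbius function. $\Omega(n)$ is the number of prime factors of $n$ counted with multiplicity, and $\omega(n)$ the number of distinct prime factors, with $\Omega(1)=\omega(1)=0$. -}

module Defs where

open import Data.Nat using (ℕ; zero; suc; _+_; _*_; _^_; _%_; _/_; _≟_)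
open import Data.Nat.Divisibility using (_∣_; _∣?_)
open import Data.Nat.Primality using (Prime; prime?)
open import Data.List using (List; []; _∷_; filter; length; map; foldr; upTo)
open import Data.Nat.ListAction using (sum)
open import Data.Integer as ℤ using (ℤ; +_; -[1+_])
open import Relation.Nullary using (does)
open import Relation.Nullary.Decidable using (_×-dec_)
open import Data.Bool using (if_then_else_)

range1 : ℕ → List ℕ
range1 n = map suc (upTo n)

ω : ℕ → ℕ
ω n = length (filter (λ p → prime? p ×-dec p ∣? n) (range1 n))

-- p-adic valuation of n ≥ 1: the number of k ≥ 1 with p^k ∣ n
-- (= the largest such k, since these k form an initial segment; k ≤ n suffices)
val : ℕ → ℕ → ℕ
val p n = length (filter (λ k → p ^ k ∣? n) (range1 n))

Ω : ℕ → ℕ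
Ω n = sum (map (λ p → val p n) (filter (λ p → prime? p ×-dec p ∣? n) (range1 n)))

μ : ℕ → ℤ
μ n = if does (Data.List.Relation.Unary.Any.any? (λ p → prime? p ×-dec (p * p) ∣? n) (range1 n))
      then + 0 else (-[1+ 0 ]) ℤ.^ ω n
  where import Data.List.Relation.Unary.Any

-- J₀^{1,3}(n) = Σ_{d ∣ n, d ≡ 1 (mod 3)} μ(n/d)
J : ℕ → ℤ
J n = foldr ℤ._+_ (+ 0) (map (λ k → μ (n / suc k))
        (filter (λ k → (suc k ∣? n) ×-dec (suc k % 3 ≟ 1)) (upTo n)))

module Submission where

-- Write J = χ₁ ⋆ μ, where χᵣ is the indicator of the residue class r mod 3 and
-- (f ⋆ μ)(n) = Σ_{d ∣ n} f(d) μ(n/d).  Sorting the divisors of p·m (p prime) by whether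
-- p divides them gives
--   (f ⋆ μ)(pm) = −(f ⋆ μ)(m) + (f(p·) ⋆ μ)(m)   if p ∤ m,
--   (f ⋆ μ)(pm) =               (f(p·) ⋆ μ)(m)   if p ∣ m.
-- Since χ₁(3d) = 0, a single factor 3 only flips the sign, and 9 ∣ n forces J(n) = 0.
-- A prime p ≡ 1 has χᵣ(pd) = χᵣ(d), so the recurrences make J vanish by induction.
-- A prime p ≡ 2 swaps χ₁ and χ₂, and a joint induction over the prime factors shows
-- χ₁ ⋆ μ = −(χ₂ ⋆ μ) = (−1)^Ω 2^(ω−1): every prime flips the sign and every new
-- distinct prime doubles the absolute value.

open import Algebra.Bundles using (CommutativeSemigroup)
open import Algebra.Core using (Op₂)
open import Algebra.Structures using (IsCommutativeMonoid)
open import Data.Bool using (true; false; if_then_else_)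
open import Data.Bool.Properties using (if-float)
open import Data.Empty using (⊥-elim)
open import Data.Integer as ℤ using (ℤ; +_; -[1+_]; 0ℤ; 1ℤ; -1ℤ)
import Data.Integer.Properties as ℤ
open import Data.Integer.Tactic.RingSolver using (solve-∀)
open import Data.List using ([]; _∷_; _∷ʳ_; [_]; map; foldr; filter; length; upTo)
open import Data.List.Properties using (map-++; map-∘; upTo-∷ʳ)
open import Data.List.Membership.Propositional using (_∈_; find; lose)
open import Data.List.Membership.Propositional.Properties using (∈-map⁺; ∈-upTo⁺)
open import Data.List.Relation.Unary.All using (_∷_)
open import Data.List.Relation.Unary.Any using (Any; any?)
open import Data.Nat
  using (ℕ; zero; suc; pred; _+_; _*_; _^_; _/_; _%_; _∸_; _≤_; _<_; _≟_; _≤?_; s≤s; z≤n)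
open import Data.Nat using (NonZero; >-nonZero; ≢-nonZero; ≢-nonZero⁻¹; nonTrivial⇒n>1)
open import Data.Nat.Coprimality using (coprime-divisor)
open import Data.Nat.DivMod using (m/n*n≡m; *-/-assoc; m*n/m*o≡n/o; %-distribˡ-*; m%n%n≡m%n; m%n<n)
open import Data.Nat.Divisibility
open import Data.Nat.Induction using (<-rec)
open import Data.Nat.ListAction using (sum; product)
open import Data.Nat.Primality using (Prime; prime?; prime⇒irreducible; prime⇒nonZero; prime⇒nonTrivial; euclidsLemma)
open import Data.Nat.Primality.Factorisation using (factorise)
open import Data.Nat.Properties
open import Data.Product using (_×_; _,_; ∃-syntax; proj₁; proj₂)
open import Data.Sum using (inj₁; inj₂; [_,_]′)
open import Defs
open import Function using (_∘_)
open import Level using (0ℓ)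
open import Relation.Binary.PropositionalEquality
  using (_≡_; _≢_; refl; sym; trans; cong; cong₂; subst; module ≡-Reasoning)
open import Relation.Nullary using (¬_; Dec; yes; no; does)
open import Relation.Nullary.Decidable using (_×-dec_; from-yes)
open import Relation.Unary using (Decidable)

if-yes : ∀ {P X : Set} (p? : Dec P) {x y : X} → P → (if does p? then x else y) ≡ x
if-yes (yes _) _ = refl
if-yes (no ¬p) p = ⊥-elim (¬p p)

if-no : ∀ {P X : Set} (p? : Dec P) {x y : X} → ¬ P → (if does p? then x else y) ≡ y
if-no (yes p) ¬p = ⊥-elim (¬p p)
if-no (no _)  _  = refl

if-does-cong : ∀ {P Q X : Set} (p? : Dec P) (q? : Dec Q) {x y z : X} →
               (P → Q) → (Q → P) → (P → x ≡ y) →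
               (if does p? then x else z) ≡ (if does q? then y else z)
if-does-cong (yes p) (yes _) _   _   x≡y = x≡y p
if-does-cong (yes p) (no ¬q) p→q _   _   = ⊥-elim (¬q (p→q p))
if-does-cong (no ¬p) (yes q) _   q→p _   = ⊥-elim (¬p (q→p q))
if-does-cong (no _)  (no _)  _   _   _   = refl

module IntervalSum {A : Set} {_∙_ : Op₂ A} {ε : A}
                   (isCommutativeMonoid : IsCommutativeMonoid _≡_ _∙_ ε) where

  open IsCommutativeMonoid isCommutativeMonoid
    using (identityˡ; identityʳ; assoc; comm; isCommutativeSemigroup)

  private
    commutativeSemigroup : CommutativeSemigroup 0ℓ 0ℓ
    commutativeSemigroup = record
      { Carrier = A ; _≈_ = _≡_ ; _∙_ = _∙_ ; isCommutativeSemigroup = isCommutativeSemigroup }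

  open import Algebra.Properties.CommutativeSemigroup commutativeSemigroup using (interchange)

  sumTo : ℕ → (ℕ → A) → A
  sumTo zero    f = ε
  sumTo (suc n) f = sumTo n f ∙ f (suc n)

  sumTo-cong : ∀ n {f g : ℕ → A} → (∀ d → 1 ≤ d → d ≤ n → f d ≡ g d) → sumTo n f ≡ sumTo n g
  sumTo-cong zero    _   = refl
  sumTo-cong (suc n) f≗g =
    cong₂ _∙_ (sumTo-cong n (λ d 1≤d d≤n → f≗g d 1≤d (m≤n⇒m≤1+n d≤n))) (f≗g (suc n) (s≤s z≤n) ≤-refl)

  foldr-∷ʳ : ∀ xs y → foldr _∙_ ε (xs ∷ʳ y) ≡ foldr _∙_ ε xs ∙ y
  foldr-∷ʳ []       y = trans (identityʳ y) (sym (identityˡ y))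
  foldr-∷ʳ (x ∷ xs) y = trans (cong (x ∙_) (foldr-∷ʳ xs y)) (sym (assoc x _ y))

  foldr-map-upTo : ∀ (g : ℕ → A) n → foldr _∙_ ε (map g (upTo n)) ≡ sumTo n (g ∘ pred)
  foldr-map-upTo g zero    = refl
  foldr-map-upTo g (suc n) = begin
    foldr _∙_ ε (map g (upTo (suc n)))   ≡⟨ cong (foldr _∙_ ε ∘ map g) (sym (upTo-∷ʳ n)) ⟩
    foldr _∙_ ε (map g (upTo n ∷ʳ n))    ≡⟨ cong (foldr _∙_ ε) (map-++ g (upTo n) [ n ]) ⟩
    foldr _∙_ ε (map g (upTo n) ∷ʳ g n)  ≡⟨ foldr-∷ʳ (map g (upTo n)) (g n) ⟩
    foldr _∙_ ε (map g (upTo n)) ∙ g n   ≡⟨ cong (_∙ g n) (foldr-map-upTo g n) ⟩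
    sumTo (suc n) (g ∘ pred)             ∎
    where open ≡-Reasoning

  foldr-map-range1 : ∀ (g : ℕ → A) n → foldr _∙_ ε (map g (range1 n)) ≡ sumTo n g
  foldr-map-range1 g n = begin
    foldr _∙_ ε (map g (map suc (upTo n)))  ≡⟨ cong (foldr _∙_ ε) (sym (map-∘ (upTo n))) ⟩
    foldr _∙_ ε (map (g ∘ suc) (upTo n))    ≡⟨ foldr-map-upTo (g ∘ suc) n ⟩
    sumTo n (g ∘ suc ∘ pred)                ≡⟨ sumTo-cong n (λ { (suc d) _ _ → refl }) ⟩
    sumTo n g                               ∎
    where open ≡-Reasoning

  foldr-map-filter : ∀ {B : Set} {P : B → Set} (P? : Decidable P) (g : B → A) xs →
                     foldr _∙_ ε (map g (filter P? xs)) ≡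
                     foldr _∙_ ε (map (λ x → if does (P? x) then g x else ε) xs)
  foldr-map-filter P? g []       = refl
  foldr-map-filter P? g (x ∷ xs) with does (P? x)
  ... | true  = cong (g x ∙_) (foldr-map-filter P? g xs)
  ... | false = trans (foldr-map-filter P? g xs) (sym (identityˡ _))

  sumTo-extend : ∀ {m} n (f : ℕ → A) → m ≤ n → (∀ d → m < d → d ≤ n → f d ≡ ε) → sumTo n f ≡ sumTo m f
  sumTo-extend zero    f z≤n _ = refl
  sumTo-extend (suc n) f m≤1+n vanish with m≤n⇒m<n∨m≡n m≤1+n
  ... | inj₂ refl      = refl
  ... | inj₁ (s≤s m≤n) =
    trans (cong₂ _∙_ (sumTo-extend n f m≤n (λ d m<d d≤n → vanish d m<d (m≤n⇒m≤1+n d≤n)))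
                     (vanish (suc n) (s≤s m≤n) ≤-refl))
          (identityʳ _)

  sumTo-ε : ∀ n (f : ℕ → A) → (∀ d → 1 ≤ d → d ≤ n → f d ≡ ε) → sumTo n f ≡ ε
  sumTo-ε n f = sumTo-extend n f z≤n

  sumTo-truncate : ∀ {m n} {P : ℕ → Set} (P? : Decidable P) (g : ℕ → A) → m ≤ n →
                   (∀ {d} → P d → d ≤ m) →
                   sumTo n (λ d → if does (P? d) then g d else ε) ≡
                   sumTo m (λ d → if does (P? d) then g d else ε)
  sumTo-truncate {n = n} P? g m≤n P⇒≤m =
    sumTo-extend n _ m≤n (λ d m<d _ → if-no (P? d) (λ Pd → <⇒≱ m<d (P⇒≤m Pd)))

  sumTo-∙ : ∀ n (f g : ℕ → A) → sumTo n (λ d → f d ∙ g d) ≡ sumTo n f ∙ sumTo n g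
  sumTo-∙ zero    f g = sym (identityʳ ε)
  sumTo-∙ (suc n) f g = trans (cong (_∙ (f (suc n) ∙ g (suc n))) (sumTo-∙ n f g)) (interchange _ _ _ _)

  sumTo-+ : ∀ m n (f : ℕ → A) → sumTo (m + n) f ≡ sumTo m f ∙ sumTo n (λ i → f (m + i))
  sumTo-+ m zero    f = trans (cong (λ k → sumTo k f) (+-identityʳ m)) (sym (identityʳ _))
  sumTo-+ m (suc n) f = begin
    sumTo (m + suc n) f                                      ≡⟨ cong (λ k → sumTo k f) (+-suc m n) ⟩
    sumTo (m + n) f ∙ f (suc (m + n))                        ≡⟨ cong₂ _∙_ (sumTo-+ m n f) (cong f (sym (+-suc m n))) ⟩
    (sumTo m f ∙ sumTo n (λ i → f (m + i))) ∙ f (m + suc n)  ≡⟨ assoc _ _ _ ⟩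
    sumTo m f ∙ sumTo (suc n) (λ i → f (m + i))              ∎
    where open ≡-Reasoning

  sumTo-suc : ∀ n (f : ℕ → A) → sumTo (suc n) f ≡ f 1 ∙ sumTo n (f ∘ suc)
  sumTo-suc zero    f = trans (identityˡ _) (sym (identityʳ _))
  sumTo-suc (suc n) f = trans (cong (_∙ f (suc (suc n))) (sumTo-suc n f)) (assoc _ _ _)

  sumTo-pick : ∀ n {j} (f g : ℕ → A) {x} → 1 ≤ j → j ≤ n → f j ≡ x ∙ g j →
               (∀ k → 1 ≤ k → k ≤ n → k ≢ j → f k ≡ g k) → sumTo n f ≡ x ∙ sumTo n g
  sumTo-pick zero    f g (s≤s _) ()
  sumTo-pick (suc n) {j} f g {x} 1≤j j≤1+n fj others with j ≟ suc n
  ... | yes refl = begin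
    sumTo n f ∙ f (suc n)  ≡⟨ cong₂ _∙_ (sumTo-cong n below) fj ⟩
    sumTo n g ∙ (x ∙ g j)  ≡⟨ sym (assoc _ _ _) ⟩
    (sumTo n g ∙ x) ∙ g j  ≡⟨ cong (_∙ g j) (comm _ _) ⟩
    (x ∙ sumTo n g) ∙ g j  ≡⟨ assoc _ _ _ ⟩
    x ∙ sumTo (suc n) g    ∎
    where
    open ≡-Reasoning
    below : ∀ k → 1 ≤ k → k ≤ n → f k ≡ g k
    below k 1≤k k≤n = others k 1≤k (m≤n⇒m≤1+n k≤n) (λ { refl → 1+n≰n k≤n })
  ... | no j≢1+n = begin
    sumTo n f ∙ f (suc n)        ≡⟨ cong₂ _∙_ (sumTo-pick n f g 1≤j j≤n fj below) atLast ⟩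
    (x ∙ sumTo n g) ∙ g (suc n)  ≡⟨ assoc _ _ _ ⟩
    x ∙ sumTo (suc n) g          ∎
    where
    open ≡-Reasoning
    j≤n : j ≤ n
    j≤n = ≤-pred (≤∧≢⇒< j≤1+n j≢1+n)
    below : ∀ k → 1 ≤ k → k ≤ n → k ≢ j → f k ≡ g k
    below k 1≤k k≤n = others k 1≤k (m≤n⇒m≤1+n k≤n)
    atLast : f (suc n) ≡ g (suc n)
    atLast = others (suc n) (s≤s z≤n) ≤-refl (j≢1+n ∘ sym)

  sumTo-multiples : ∀ p n (f : ℕ → A) .{{_ : NonZero p}} → (∀ j → p ∤ j → f j ≡ ε) →
                    sumTo (p * n) f ≡ sumTo n (f ∘ (p *_))
  sumTo-multiples p zero    f _ = cong (λ k → sumTo k f) (*-zeroʳ p)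
  sumTo-multiples p@(suc p′) (suc n) f off = begin
    sumTo (p * suc n) f                              ≡⟨ cong (λ k → sumTo k f) p*[1+n]≡p*n+p ⟩
    sumTo (p * n + p) f                              ≡⟨ sumTo-+ (p * n) p f ⟩
    sumTo (p * n) f ∙ sumTo p (λ i → f (p * n + i))  ≡⟨ cong₂ _∙_ (sumTo-multiples p n f off) lastBlock ⟩
    sumTo n (f ∘ (p *_)) ∙ f (p * suc n)             ∎
    where
    open ≡-Reasoning
    p*[1+n]≡p*n+p : p * suc n ≡ p * n + p
    p*[1+n]≡p*n+p = trans (*-suc p n) (+-comm p (p * n))
    lastBlock : sumTo p (λ i → f (p * n + i)) ≡ f (p * suc n)
    p∤p*n+i : ∀ i → 1 ≤ i → i ≤ p′ → p ∤ p * n + i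
    p∤p*n+i i 1≤i i≤p′ p∣p*n+i = <⇒≱ (s≤s i≤p′) (∣⇒≤ {{>-nonZero 1≤i}} (∣m+n∣m⇒∣n p∣p*n+i (m∣m*n n)))
    lastBlock = begin
      sumTo p′ (λ i → f (p * n + i)) ∙ f (p * n + p)
        ≡⟨ cong₂ _∙_ (sumTo-ε p′ _ λ i 1≤i i≤p′ → off _ (p∤p*n+i i 1≤i i≤p′)) (cong f (sym p*[1+n]≡p*n+p)) ⟩
      ε ∙ f (p * suc n)  ≡⟨ identityˡ _ ⟩
      f (p * suc n)      ∎

module ℕΣ = IntervalSum +-0-isCommutativeMonoid

𝟙 : ∀ {P : Set} → Dec P → ℕ
𝟙 p? = if does p? then 1 else 0

length-filter≡sum : ∀ {A : Set} {P : A → Set} (P? : Decidable P) xs →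
                    length (filter P? xs) ≡ sum (map (𝟙 ∘ P?) xs)
length-filter≡sum P? []       = refl
length-filter≡sum P? (x ∷ xs) with does (P? x)
... | true  = cong suc (length-filter≡sum P? xs)
... | false = length-filter≡sum P? xs

length-filter-range1 : ∀ {P : ℕ → Set} (P? : Decidable P) n →
                       length (filter P? (range1 n)) ≡ ℕΣ.sumTo n (𝟙 ∘ P?)
length-filter-range1 P? n = trans (length-filter≡sum P? (range1 n)) (ℕΣ.foldr-map-range1 (𝟙 ∘ P?) n)

term≤sumTo : ∀ n (f : ℕ → ℕ) {j} → 1 ≤ j → j ≤ n → f j ≤ ℕΣ.sumTo n f
term≤sumTo zero    f (s≤s _) ()
term≤sumTo (suc n) f {j} 1≤j j≤1+n with j ≟ suc n
... | yes refl  = m≤n+m (f j) (ℕΣ.sumTo n f)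
... | no j≢1+n = ≤-trans (term≤sumTo n f 1≤j (≤-pred (≤∧≢⇒< j≤1+n j≢1+n))) (m≤m+n _ _)

primeFactor? : ∀ n → Decidable (λ p → Prime p × p ∣ n)
primeFactor? n p = prime? p ×-dec p ∣? n

ω≡sumTo : ∀ n → ω n ≡ ℕΣ.sumTo n (𝟙 ∘ primeFactor? n)
ω≡sumTo n = length-filter-range1 (primeFactor? n) n

val≡sumTo : ∀ p n → val p n ≡ ℕΣ.sumTo n (λ k → 𝟙 (p ^ k ∣? n))
val≡sumTo p n = length-filter-range1 (λ k → p ^ k ∣? n) n

Ω≡sumTo : ∀ n → Ω n ≡ ℕΣ.sumTo n (λ q → if does (primeFactor? n q) then val q n else 0)
Ω≡sumTo n = trans (ℕΣ.foldr-map-filter (primeFactor? n) (λ q → val q n) (range1 n))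
                  (ℕΣ.foldr-map-range1 _ n)

prime⇒>1 : ∀ {p} → Prime p → 1 < p
prime⇒>1 {p} p-prime = nonTrivial⇒n>1 p {{prime⇒nonTrivial p-prime}}

prime∣prime⇒≡ : ∀ {p q} → Prime p → Prime q → p ∣ q → p ≡ q
prime∣prime⇒≡ p-prime q-prime p∣q with prime⇒irreducible q-prime p∣q
... | inj₁ refl = ⊥-elim (<-irrefl refl (prime⇒>1 p-prime))
... | inj₂ p≡q  = p≡q

∣p*n⇒∣n : ∀ {p a n} → Prime p → p ∤ a → a ∣ p * n → a ∣ n
∣p*n⇒∣n {p} {a} p-prime p∤a = coprime-divisor a⊥p
  where
  a⊥p : ∀ {d} → d ∣ a × d ∣ p → d ≡ 1
  a⊥p (d∣a , d∣p) with prime⇒irreducible p-prime d∣p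
  ... | inj₁ d≡1  = d≡1
  ... | inj₂ refl = ⊥-elim (p∤a d∣a)

prime∤1 : ∀ {p} → Prime p → p ∤ 1
prime∤1 p-prime p∣1 = <-irrefl (sym (∣1⇒≡1 p∣1)) (prime⇒>1 p-prime)

prime∤prime^ : ∀ {p q} → Prime p → Prime q → p ≢ q → ∀ k → p ∤ q ^ k
prime∤prime^ p-prime q-prime p≢q zero    = prime∤1 p-prime
prime∤prime^ p-prime q-prime p≢q (suc k) p∣q^[1+k] with euclidsLemma _ _ p-prime p∣q^[1+k]
... | inj₁ p∣q   = p≢q (prime∣prime⇒≡ p-prime q-prime p∣q)
... | inj₂ p∣q^k = prime∤prime^ p-prime q-prime p≢q k p∣q^k

n<m^n : ∀ {m} n → 1 < m → n < m ^ n
n<m^n zero        _   = s≤s z≤n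
n<m^n {m} (suc n) 1<m = ≤-<-trans (n<m^n n 1<m) (^-monoʳ-< m 1<m (n<1+n n))

^∣⇒≤ : ∀ {q k e} .{{_ : NonZero e}} → 1 < q → q ^ k ∣ e → k ≤ e
^∣⇒≤ {k = k} 1<q q^k∣e = <⇒≤ (<-≤-trans (n<m^n k 1<q) (∣⇒≤ q^k∣e))

∃prime∣ : ∀ {m} → 1 < m → ∃[ p ] (Prime p × p ∣ m)
∃prime∣ {1} (s≤s ())
∃prime∣ {m@(suc (suc _))} _ with factorise m
... | record { factors = [] ; isFactorisation = () }
... | record { factors = p ∷ ps ; isFactorisation = m≡p*Πps ; factorsPrime = p-prime ∷ _ } =
  p , p-prime , subst (p ∣_) (sym m≡p*Πps) (m∣m*n (product ps))

prime-*-induction : (P : ℕ → Set) → (∀ {p} → Prime p → P p) →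
                    (∀ {p k} → Prime p → 1 < k → P k → P (p * k)) → ∀ m → 1 < m → P m
prime-*-induction P base step = <-rec (λ m → 1 < m → P m) induct
  where
  induct : ∀ m → (∀ {j} → j < m → 1 < j → P j) → 1 < m → P m
  induct m ih 1<m with ∃prime∣ 1<m
  ... | p , p-prime , divides-refl 0 = ⊥-elim (n≮0 1<m)
  ... | p , p-prime , divides-refl 1 = subst P (sym (*-identityˡ p)) (base p-prime)
  ... | p , p-prime , divides-refl k@(suc (suc _)) =
    subst P (*-comm p k) (step p-prime 1<k (ih (m<m*n k p (prime⇒>1 p-prime)) 1<k))
    where
    1<k : 1 < k
    1<k = s≤s (s≤s z≤n)

∈-range1 : ∀ {q n} → 1 ≤ q → q ≤ n → q ∈ range1 n
∈-range1 {suc q} _ q≤n = ∈-map⁺ suc (∈-upTo⁺ q≤n)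

Squareful : ℕ → Set
Squareful n = Any (λ q → Prime q × q * q ∣ n) (range1 n)

squareful? : ∀ n → Dec (Squareful n)
squareful? n = any? (λ q → prime? q ×-dec (q * q) ∣? n) (range1 n)

μ≡0 : ∀ {n q} .{{_ : NonZero n}} → Prime q → q * q ∣ n → μ n ≡ 0ℤ
μ≡0 {n} {q} q-prime q²∣n = if-yes (squareful? n)
  (lose (∈-range1 (<⇒≤ (prime⇒>1 q-prime)) (∣⇒≤ (∣-trans (m∣m*n q) q²∣n))) (q-prime , q²∣n))

μ≡-1^ω : ∀ {n} → ¬ Squareful n → μ n ≡ -1ℤ ℤ.^ ω n
μ≡-1^ω {n} squarefree = if-no (squareful? n) squarefree

module ℤΣ = IntervalSum ℤ.+-0-isCommutativeMonoid

infixl 7 _÷_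

-- The junk value n ÷ 0 = 0 lets the quotient appear under a binder ranging over all d.
_÷_ : ℕ → ℕ → ℕ
n ÷ zero  = 0
n ÷ suc d = n / suc d

÷-* : ∀ {m d} .{{_ : NonZero d}} → d ∣ m → m ÷ d * d ≡ m
÷-* {d = suc _} = m/n*n≡m

÷-nonZero : ∀ {m d} .{{_ : NonZero m}} .{{_ : NonZero d}} → d ∣ m → NonZero (m ÷ d)
÷-nonZero {m} {d} d∣m = ≢-nonZero λ m÷d≡0 → ≢-nonZero⁻¹ m (trans (sym (÷-* d∣m)) (cong (_* d) m÷d≡0))

*-÷-assoc : ∀ p {m d} .{{_ : NonZero d}} → d ∣ m → p * m ÷ d ≡ p * (m ÷ d)
*-÷-assoc p {d = suc _} = *-/-assoc p

*-÷-*-cancel : ∀ p m k .{{_ : NonZero p}} .{{_ : NonZero k}} → p * m ÷ (p * k) ≡ m ÷ k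
*-÷-*-cancel (suc p) m (suc k) = m*n/m*o≡n/o (suc p) m (suc k)

infix 9 _⋆μ_

_⋆μ_ : (ℕ → ℤ) → ℕ → ℤ
f ⋆μ n = ℤΣ.sumTo n (λ d → if does (d ∣? n) then f d ℤ.* μ (n ÷ d) else 0ℤ)

⋆μ-cong : ∀ {f g : ℕ → ℤ} n → (∀ d → f d ≡ g d) → f ⋆μ n ≡ g ⋆μ n
⋆μ-cong n f≗g = ℤΣ.sumTo-cong n λ d _ _ →
  cong (λ x → if does (d ∣? n) then x ℤ.* μ (n ÷ d) else 0ℤ) (f≗g d)

⋆μ-zero : ∀ {f : ℕ → ℤ} n → (∀ d → f d ≡ 0ℤ) → f ⋆μ n ≡ 0ℤ
⋆μ-zero {f} n f≗0 = ℤΣ.sumTo-ε n _ λ d _ _ → zeroTerm d (does (d ∣? n))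
  where
  zeroTerm : ∀ d b → (if b then f d ℤ.* μ (n ÷ d) else 0ℤ) ≡ 0ℤ
  zeroTerm d true  = cong (ℤ._* μ (n ÷ d)) (f≗0 d)
  zeroTerm d false = refl

sumTo-neg : ∀ n (g : ℕ → ℤ) → ℤΣ.sumTo n (ℤ.-_ ∘ g) ≡ ℤ.- ℤΣ.sumTo n g
sumTo-neg zero    g = refl
sumTo-neg (suc n) g = trans (cong (ℤ._+ ℤ.- g (suc n)) (sumTo-neg n g)) (sym (ℤ.neg-distrib-+ (ℤΣ.sumTo n g) (g (suc n))))

module _ {p} (p-prime : Prime p) where

  private instance
    p≢0 : NonZero p
    p≢0 = prime⇒nonZero p-prime
    p*n≢0 : ∀ {n} .{{_ : NonZero n}} → NonZero (p * n)
    p*n≢0 {n} = m*n≢0 p n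

  n≤p*n : ∀ n → n ≤ p * n
  n≤p*n n = m≤n*m n p

  n<p*n : ∀ n .{{_ : NonZero n}} → n < p * n
  n<p*n n = subst (n <_) (*-comm n p) (m<m*n n p (prime⇒>1 p-prime))

  prime∣p*n⇒∣n : ∀ {q n} → Prime q → q ≢ p → q ∣ p * n → q ∣ n
  prime∣p*n⇒∣n q-prime q≢p = ∣p*n⇒∣n p-prime (q≢p ∘ sym ∘ prime∣prime⇒≡ p-prime q-prime)

  private
    primeFactor-*-≢ : ∀ {q e} {x y : ℕ} → q ≢ p → (Prime q → x ≡ y) →
                      (if does (primeFactor? (p * e) q) then x else 0) ≡
                      (if does (primeFactor? e q) then y else 0)
    primeFactor-*-≢ {q} {e} q≢p x≡y = if-does-cong (primeFactor? (p * e) q) (primeFactor? e q)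
      (λ (q-prime , q∣p*e) → q-prime , prime∣p*n⇒∣n q-prime q≢p q∣p*e)
      (λ (q-prime , q∣e) → q-prime , ∣-trans q∣e (n∣m*n p))
      (x≡y ∘ proj₁)

    sumTo-primeFactors-* : ∀ e .{{_ : NonZero e}} (g : ℕ → ℕ) →
      ℕΣ.sumTo (p * e) (λ q → if does (primeFactor? e q) then g q else 0) ≡
      ℕΣ.sumTo e (λ q → if does (primeFactor? e q) then g q else 0)
    sumTo-primeFactors-* e g = ℕΣ.sumTo-truncate (primeFactor? e) g (n≤p*n e) (∣⇒≤ ∘ proj₂)

    1≤p : 1 ≤ p
    1≤p = <⇒≤ (prime⇒>1 p-prime)

    p≤p*e : ∀ e .{{_ : NonZero e}} → p ≤ p * e
    p≤p*e e = ∣⇒≤ (m∣m*n e)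

  ω-*-∤ : ∀ {e} .{{_ : NonZero e}} → p ∤ e → ω (p * e) ≡ suc (ω e)
  ω-*-∤ {e} p∤e = begin
    ω (p * e)                                    ≡⟨ ω≡sumTo (p * e) ⟩
    ℕΣ.sumTo (p * e) (𝟙 ∘ primeFactor? (p * e))  ≡⟨ ℕΣ.sumTo-pick (p * e) _ _ 1≤p (p≤p*e e) atP others ⟩
    1 + ℕΣ.sumTo (p * e) (𝟙 ∘ primeFactor? e)    ≡⟨ cong suc (sumTo-primeFactors-* e _) ⟩
    1 + ℕΣ.sumTo e (𝟙 ∘ primeFactor? e)          ≡⟨ cong suc (ω≡sumTo e) ⟨
    suc (ω e)                                    ∎
    where
    open ≡-Reasoning
    atP : 𝟙 (primeFactor? (p * e) p) ≡ 1 + 𝟙 (primeFactor? e p)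
    atP = trans (if-yes (primeFactor? (p * e) p) (p-prime , m∣m*n e))
                (cong suc (sym (if-no (primeFactor? e p) (p∤e ∘ proj₂))))
    others : ∀ q → 1 ≤ q → q ≤ p * e → q ≢ p → 𝟙 (primeFactor? (p * e) q) ≡ 𝟙 (primeFactor? e q)
    others q _ _ q≢p = primeFactor-*-≢ q≢p (λ _ → refl)

  ω-*-∣ : ∀ {e} .{{_ : NonZero e}} → p ∣ e → ω (p * e) ≡ ω e
  ω-*-∣ {e} p∣e = begin
    ω (p * e)                                    ≡⟨ ω≡sumTo (p * e) ⟩
    ℕΣ.sumTo (p * e) (𝟙 ∘ primeFactor? (p * e))  ≡⟨ ℕΣ.sumTo-cong (p * e) (λ q _ _ → sameTerm q) ⟩
    ℕΣ.sumTo (p * e) (𝟙 ∘ primeFactor? e)        ≡⟨ sumTo-primeFactors-* e _ ⟩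
    ℕΣ.sumTo e (𝟙 ∘ primeFactor? e)              ≡⟨ ω≡sumTo e ⟨
    ω e                                          ∎
    where
    open ≡-Reasoning
    sameTerm : ∀ q → 𝟙 (primeFactor? (p * e) q) ≡ 𝟙 (primeFactor? e q)
    sameTerm q with q ≟ p
    ... | yes refl = trans (if-yes (primeFactor? (p * e) p) (p-prime , m∣m*n e))
                           (sym (if-yes (primeFactor? e p) (p-prime , p∣e)))
    ... | no q≢p   = primeFactor-*-≢ q≢p λ _ → refl

  val-∤ : ∀ {e} → p ∤ e → val p e ≡ 0
  val-∤ {e} p∤e = trans (val≡sumTo p e) (ℕΣ.sumTo-ε e _ λ
    { (suc k) _ _ → if-no (p ^ suc k ∣? e) (λ p^[1+k]∣e → p∤e (∣-trans (m∣m*n (p ^ k)) p^[1+k]∣e)) })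

  val-*-self : ∀ {e} .{{_ : NonZero e}} → val p (p * e) ≡ suc (val p e)
  val-*-self {e} = begin
    val p (p * e)                            ≡⟨ val≡sumTo p (p * e) ⟩
    ℕΣ.sumTo (p * e) f                       ≡⟨ cong (λ n → ℕΣ.sumTo n f) (suc-pred (p * e)) ⟨
    ℕΣ.sumTo (suc (pred (p * e))) f          ≡⟨ ℕΣ.sumTo-suc (pred (p * e)) f ⟩
    f 1 + ℕΣ.sumTo (pred (p * e)) (f ∘ suc)  ≡⟨ cong₂ _+_ f1≡1 (ℕΣ.sumTo-cong (pred (p * e)) (λ k _ _ → cancelP k)) ⟩
    1 + ℕΣ.sumTo (pred (p * e)) g            ≡⟨ cong suc (ℕΣ.sumTo-truncate (λ k → p ^ k ∣? e) _ e≤pred[p*e] p^k∣⇒k≤) ⟩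
    1 + ℕΣ.sumTo e g                         ≡⟨ cong suc (val≡sumTo p e) ⟨
    suc (val p e)                            ∎
    where
    open ≡-Reasoning
    f g : ℕ → ℕ
    f k = 𝟙 (p ^ k ∣? p * e)
    g k = 𝟙 (p ^ k ∣? e)
    f1≡1 : f 1 ≡ 1
    f1≡1 = if-yes (p ^ 1 ∣? p * e) (*-monoʳ-∣ p (1∣ e))
    cancelP : ∀ k → f (suc k) ≡ g k
    cancelP k = if-does-cong (p ^ suc k ∣? p * e) (p ^ k ∣? e) (*-cancelˡ-∣ p) (*-monoʳ-∣ p) (λ _ → refl)
    e≤pred[p*e] : e ≤ pred (p * e)
    e≤pred[p*e] = <⇒≤pred (n<p*n e)
    p^k∣⇒k≤ : ∀ {k} → p ^ k ∣ e → k ≤ e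
    p^k∣⇒k≤ = ^∣⇒≤ (prime⇒>1 p-prime)

  val-*-≢ : ∀ {q e} .{{_ : NonZero e}} → Prime q → q ≢ p → val q (p * e) ≡ val q e
  val-*-≢ {q} {e} q-prime q≢p = begin
    val q (p * e)                                ≡⟨ val≡sumTo q (p * e) ⟩
    ℕΣ.sumTo (p * e) (λ k → 𝟙 (q ^ k ∣? p * e))  ≡⟨ ℕΣ.sumTo-cong (p * e) (λ k _ _ → sameTerm k) ⟩
    ℕΣ.sumTo (p * e) (λ k → 𝟙 (q ^ k ∣? e))      ≡⟨ ℕΣ.sumTo-truncate (λ k → q ^ k ∣? e) _ (n≤p*n e) q^k∣⇒k≤ ⟩
    ℕΣ.sumTo e (λ k → 𝟙 (q ^ k ∣? e))            ≡⟨ val≡sumTo q e ⟨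
    val q e                                      ∎
    where
    open ≡-Reasoning
    sameTerm : ∀ k → 𝟙 (q ^ k ∣? p * e) ≡ 𝟙 (q ^ k ∣? e)
    sameTerm k = if-does-cong (q ^ k ∣? p * e) (q ^ k ∣? e)
      (∣p*n⇒∣n p-prime (prime∤prime^ p-prime q-prime (q≢p ∘ sym) k))
      (λ q^k∣e → ∣-trans q^k∣e (n∣m*n p))
      (λ _ → refl)
    q^k∣⇒k≤ : ∀ {k} → q ^ k ∣ e → k ≤ e
    q^k∣⇒k≤ = ^∣⇒≤ (prime⇒>1 q-prime)

  Ω-* : ∀ {e} .{{_ : NonZero e}} → Ω (p * e) ≡ suc (Ω e)
  Ω-* {e} = begin
    Ω (p * e)               ≡⟨ Ω≡sumTo (p * e) ⟩
    ℕΣ.sumTo (p * e) F      ≡⟨ ℕΣ.sumTo-pick (p * e) F G 1≤p (p≤p*e e) atP others ⟩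
    1 + ℕΣ.sumTo (p * e) G  ≡⟨ cong suc (sumTo-primeFactors-* e _) ⟩
    1 + ℕΣ.sumTo e G        ≡⟨ cong suc (Ω≡sumTo e) ⟨
    suc (Ω e)               ∎
    where
    open ≡-Reasoning
    F G : ℕ → ℕ
    F q = if does (primeFactor? (p * e) q) then val q (p * e) else 0
    G q = if does (primeFactor? e q) then val q e else 0
    valAtP : Dec (p ∣ e) → val p e ≡ G p
    valAtP (yes p∣e) = sym (if-yes (primeFactor? e p) (p-prime , p∣e))
    valAtP (no p∤e)  = trans (val-∤ p∤e) (sym (if-no (primeFactor? e p) (p∤e ∘ proj₂)))
    atP : F p ≡ 1 + G p
    atP = trans (if-yes (primeFactor? (p * e) p) (p-prime , m∣m*n e)) (trans val-*-self (cong suc (valAtP (p ∣? e))))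
    others : ∀ q → 1 ≤ q → q ≤ p * e → q ≢ p → F q ≡ G q
    others q _ _ q≢p = primeFactor-*-≢ q≢p (λ q-prime → val-*-≢ q-prime q≢p)

  Ω-^* : ∀ b m .{{_ : NonZero m}} → Ω (p ^ b * m) ≡ b + Ω m
  Ω-^* zero    m = cong Ω (*-identityˡ m)
  Ω-^* (suc b) m = begin
    Ω (p ^ suc b * m)    ≡⟨ cong Ω (*-assoc p (p ^ b) m) ⟩
    Ω (p * (p ^ b * m))  ≡⟨ Ω-* {{m*n≢0 (p ^ b) m {{m^n≢0 p b}}}} ⟩
    suc (Ω (p ^ b * m))  ≡⟨ cong suc (Ω-^* b m) ⟩
    suc b + Ω m          ∎
    where open ≡-Reasoning

  μ-*-∣ : ∀ {e} .{{_ : NonZero e}} → p ∣ e → μ (p * e) ≡ 0ℤ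
  μ-*-∣ p∣e = μ≡0 p-prime (*-monoʳ-∣ p p∣e)

  μ-*-∤ : ∀ {e} .{{_ : NonZero e}} → p ∤ e → μ (p * e) ≡ ℤ.- μ e
  μ-*-∤ {e} p∤e = bySquarefreeness (squareful? e)
    where
    bySquarefreeness : Dec (Squareful e) → μ (p * e) ≡ ℤ.- μ e
    bySquarefreeness (yes squareful) = let (q , _ , q-prime , q²∣e) = find squareful in
      trans (μ≡0 q-prime (∣-trans q²∣e (n∣m*n p))) (cong ℤ.-_ (sym (μ≡0 q-prime q²∣e)))
    bySquarefreeness (no squarefree) = begin
      μ (p * e)            ≡⟨ μ≡-1^ω squarefree[p*e] ⟩
      -1ℤ ℤ.^ ω (p * e)    ≡⟨ cong (-1ℤ ℤ.^_) (ω-*-∤ p∤e) ⟩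
      -1ℤ ℤ.* -1ℤ ℤ.^ ω e  ≡⟨ ℤ.-1*i≡-i _ ⟩
      ℤ.- (-1ℤ ℤ.^ ω e)    ≡⟨ cong ℤ.-_ (μ≡-1^ω squarefree) ⟨
      ℤ.- μ e              ∎
      where
      open ≡-Reasoning
      squarefree[p*e] : ¬ Squareful (p * e)
      squarefree[p*e] squareful with find squareful
      ... | q , _ , q-prime , q²∣p*e with q ≟ p
      ...   | yes refl = p∤e (*-cancelˡ-∣ p q²∣p*e)
      ...   | no q≢p   = squarefree (lose q∈range1[e] (q-prime , q²∣e))
        where
        p∤q : p ∤ q
        p∤q = q≢p ∘ sym ∘ prime∣prime⇒≡ p-prime q-prime
        p∤q² : p ∤ q * q
        p∤q² p∣q² = [ p∤q , p∤q ]′ (euclidsLemma q q p-prime p∣q²)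
        q²∣e : q * q ∣ e
        q²∣e = ∣p*n⇒∣n p-prime p∤q² q²∣p*e
        q∈range1[e] : q ∈ range1 e
        q∈range1[e] = ∈-range1 (<⇒≤ (prime⇒>1 q-prime)) (∣⇒≤ (∣-trans (m∣m*n q) q²∣e))

  module _ (f : ℕ → ℤ) (m : ℕ) .{{_ : NonZero m}} where

    private
      summand : ℕ → ℤ
      summand d = if does (d ∣? p * m) then f d ℤ.* μ (p * m ÷ d) else 0ℤ

      termsWith-p∤d termsWith-p∣d : ℕ → ℤ
      termsWith-p∤d d = if does (p ∣? d) then 0ℤ else summand d
      termsWith-p∣d d = if does (p ∣? d) then summand d else 0ℤ

      split : f ⋆μ (p * m) ≡ ℤΣ.sumTo (p * m) termsWith-p∤d ℤ.+ ℤΣ.sumTo (p * m) termsWith-p∣d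
      split = trans (ℤΣ.sumTo-cong (p * m) (λ d _ _ → byCases (p ∣? d) (summand d)))
                    (ℤΣ.sumTo-∙ (p * m) termsWith-p∤d termsWith-p∣d)
        where
        byCases : ∀ {P : Set} (p? : Dec P) x → x ≡ (if does p? then 0ℤ else x) ℤ.+ (if does p? then x else 0ℤ)
        byCases (yes _) x = sym (ℤ.+-identityˡ x)
        byCases (no _)  x = sym (ℤ.+-identityʳ x)

      sum-p∣d : ℤΣ.sumTo (p * m) termsWith-p∣d ≡ (f ∘ (p *_)) ⋆μ m
      sum-p∣d = trans (ℤΣ.sumTo-multiples p m termsWith-p∣d (λ j p∤j → if-no (p ∣? j) p∤j))
                      (ℤΣ.sumTo-cong m λ k 1≤k _ → trans (if-yes (p ∣? p * k) (m∣m*n k)) (dilate k {{>-nonZero 1≤k}}))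
        where
        dilate : ∀ k .{{_ : NonZero k}} → summand (p * k) ≡ (if does (k ∣? m) then f (p * k) ℤ.* μ (m ÷ k) else 0ℤ)
        dilate k = if-does-cong (p * k ∣? p * m) (k ∣? m) (*-cancelˡ-∣ p) (*-monoʳ-∣ p)
                     (λ _ → cong (λ x → f (p * k) ℤ.* μ x) (*-÷-*-cancel p m k))

      μ[p*m÷d]-∤ : ∀ {d} .{{_ : NonZero d}} → p ∤ m → d ∣ m → μ (p * m ÷ d) ≡ ℤ.- μ (m ÷ d)
      μ[p*m÷d]-∤ {d} p∤m d∣m = trans (cong μ (*-÷-assoc p d∣m)) (μ-*-∤ {{÷-nonZero d∣m}} p∤m÷d)
        where
        p∤m÷d : p ∤ m ÷ d
        p∤m÷d p∣m÷d = p∤m (subst (p ∣_) (÷-* d∣m) (∣-trans p∣m÷d (m∣m*n d)))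

      μ[p*m÷d]-∣ : ∀ {d} .{{_ : NonZero d}} → p ∣ m → p ∤ d → d ∣ m → μ (p * m ÷ d) ≡ 0ℤ
      μ[p*m÷d]-∣ {d} p∣m p∤d d∣m = trans (cong μ (*-÷-assoc p d∣m)) (μ-*-∣ {{÷-nonZero d∣m}} p∣m÷d)
        where
        p∣m÷d : p ∣ m ÷ d
        p∣m÷d with euclidsLemma (m ÷ d) d p-prime (subst (p ∣_) (sym (÷-* d∣m)) p∣m)
        ... | inj₁ p∣m÷d = p∣m÷d
        ... | inj₂ p∣d   = ⊥-elim (p∤d p∣d)

      sum-p∤d-∤ : p ∤ m → ℤΣ.sumTo (p * m) termsWith-p∤d ≡ ℤ.- (f ⋆μ m)
      sum-p∤d-∤ p∤m = begin
        ℤΣ.sumTo (p * m) termsWith-p∤d  ≡⟨ ℤΣ.sumTo-cong (p * m) (λ d 1≤d _ → negated d {{>-nonZero 1≤d}} (p ∣? d)) ⟩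
        ℤΣ.sumTo (p * m) (ℤ.-_ ∘ g)     ≡⟨ sumTo-neg (p * m) g ⟩
        ℤ.- ℤΣ.sumTo (p * m) g          ≡⟨ cong ℤ.-_ (ℤΣ.sumTo-truncate (λ d → d ∣? m) _ (n≤p*n m) ∣⇒≤) ⟩
        ℤ.- (f ⋆μ m)                    ∎
        where
        open ≡-Reasoning
        g : ℕ → ℤ
        g d = if does (d ∣? m) then f d ℤ.* μ (m ÷ d) else 0ℤ
        negated : ∀ d .{{_ : NonZero d}} → Dec (p ∣ d) → termsWith-p∤d d ≡ ℤ.- g d
        negated d (yes p∣d) = trans (if-yes (p ∣? d) p∣d)
                                    (cong ℤ.-_ (sym (if-no (d ∣? m) (p∤m ∘ ∣-trans p∣d))))
        negated d (no p∤d)  = begin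
          termsWith-p∤d d                                          ≡⟨ if-no (p ∣? d) p∤d ⟩
          summand d                                                ≡⟨ if-does-cong (d ∣? p * m) (d ∣? m) d∣m d∣p*m negate ⟩
          (if does (d ∣? m) then ℤ.- (f d ℤ.* μ (m ÷ d)) else 0ℤ)  ≡⟨ if-float ℤ.-_ (does (d ∣? m)) ⟨
          ℤ.- g d                                                  ∎
          where
          d∣m : d ∣ p * m → d ∣ m
          d∣m = ∣p*n⇒∣n p-prime p∤d
          d∣p*m : d ∣ m → d ∣ p * m
          d∣p*m d∣m = ∣-trans d∣m (n∣m*n p)
          negate : d ∣ p * m → f d ℤ.* μ (p * m ÷ d) ≡ ℤ.- (f d ℤ.* μ (m ÷ d))
          negate d∣p*m = trans (cong (f d ℤ.*_) (μ[p*m÷d]-∤ p∤m (d∣m d∣p*m))) (sym (ℤ.neg-distribʳ-* (f d) _))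

      sum-p∤d-∣ : p ∣ m → ℤΣ.sumTo (p * m) termsWith-p∤d ≡ 0ℤ
      sum-p∤d-∣ p∣m = ℤΣ.sumTo-ε (p * m) termsWith-p∤d (λ d 1≤d _ → vanishes d {{>-nonZero 1≤d}} (p ∣? d))
        where
        vanishes : ∀ d .{{_ : NonZero d}} → Dec (p ∣ d) → termsWith-p∤d d ≡ 0ℤ
        vanishes d (yes p∣d) = if-yes (p ∣? d) p∣d
        vanishes d (no p∤d)  = trans (if-no (p ∣? d) p∤d) (zeroIfDivides (d ∣? p * m))
          where
          zeroIfDivides : Dec (d ∣ p * m) → summand d ≡ 0ℤ
          zeroIfDivides (no d∤p*m)  = if-no (d ∣? p * m) d∤p*m
          zeroIfDivides (yes d∣p*m) = trans (if-yes (d ∣? p * m) d∣p*m)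
            (trans (cong (f d ℤ.*_) (μ[p*m÷d]-∣ p∣m p∤d (∣p*n⇒∣n p-prime p∤d d∣p*m))) (ℤ.*-zeroʳ (f d)))

    ⋆μ-*-∤ : p ∤ m → f ⋆μ (p * m) ≡ ℤ.- (f ⋆μ m) ℤ.+ (f ∘ (p *_)) ⋆μ m
    ⋆μ-*-∤ p∤m = trans split (cong₂ ℤ._+_ (sum-p∤d-∤ p∤m) sum-p∣d)

    ⋆μ-*-∣ : p ∣ m → f ⋆μ (p * m) ≡ (f ∘ (p *_)) ⋆μ m
    ⋆μ-*-∣ p∣m = trans split (trans (cong₂ ℤ._+_ (sum-p∤d-∣ p∣m) sum-p∣d) (ℤ.+-identityˡ _))

⋆μ-vanish : ∀ (f : ℕ → ℤ) {q m} .{{_ : NonZero m}} → Prime q → (∀ d → f (q * d) ≡ f d) →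
            q ∣ m → f ⋆μ m ≡ 0ℤ
⋆μ-vanish f {q} q-prime f-invariant (divides-refl k) =
  subst (λ m → f ⋆μ m ≡ 0ℤ) (*-comm q k) (<-rec P vanish k {{m*n≢0⇒m≢0 k}})
  where
  P : ℕ → Set
  P k = .{{_ : NonZero k}} → f ⋆μ (q * k) ≡ 0ℤ
  vanish : ∀ k → (∀ {j} → j < k → P j) → P k
  vanish k ih with q ∣? k
  ... | no q∤k = begin
    f ⋆μ (q * k)                        ≡⟨ ⋆μ-*-∤ q-prime f k q∤k ⟩
    ℤ.- (f ⋆μ k) ℤ.+ (f ∘ (q *_)) ⋆μ k  ≡⟨ cong (ℤ._+_ (ℤ.- (f ⋆μ k))) (⋆μ-cong k f-invariant) ⟩
    ℤ.- (f ⋆μ k) ℤ.+ f ⋆μ k             ≡⟨ ℤ.+-inverseˡ (f ⋆μ k) ⟩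
    0ℤ                                  ∎
    where open ≡-Reasoning
  ... | yes (divides-refl j) = begin
    f ⋆μ (q * (j * q))       ≡⟨ ⋆μ-*-∣ q-prime f (j * q) (n∣m*n j) ⟩
    (f ∘ (q *_)) ⋆μ (j * q)  ≡⟨ ⋆μ-cong (j * q) f-invariant ⟩
    f ⋆μ (j * q)             ≡⟨ cong (f ⋆μ_) (*-comm j q) ⟩
    f ⋆μ (q * j)             ≡⟨ ih (m<m*n j q (prime⇒>1 q-prime)) ⟩
    0ℤ                       ∎
    where
    open ≡-Reasoning
    instance
      j≢0 : NonZero j
      j≢0 = m*n≢0⇒m≢0 j

χ : ℕ → ℕ → ℤ
χ r d = if does (d % 3 ≟ r) then 1ℤ else 0ℤ

J≡χ₁⋆μ : ∀ n → J n ≡ χ 1 ⋆μ n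
J≡χ₁⋆μ n = begin
  J n                                                                    ≡⟨ ℤΣ.foldr-map-filter P? g (upTo n) ⟩
  foldr ℤ._+_ 0ℤ (map (λ k → if does (P? k) then g k else 0ℤ) (upTo n))  ≡⟨ ℤΣ.foldr-map-upTo _ n ⟩
  ℤΣ.sumTo n (λ d → if does (P? (pred d)) then g (pred d) else 0ℤ)       ≡⟨ ℤΣ.sumTo-cong n termwise ⟩
  χ 1 ⋆μ n                                                               ∎
  where
  open ≡-Reasoning
  P? : Decidable (λ k → suc k ∣ n × suc k % 3 ≡ 1)
  P? k = (suc k ∣? n) ×-dec (suc k % 3 ≟ 1)
  g : ℕ → ℤ
  g k = μ (n / suc k)
  conj : ∀ {A B : Set} (a? : Dec A) (b? : Dec B) (x : ℤ) →
         (if does (a? ×-dec b?) then x else 0ℤ) ≡ (if does a? then (if does b? then 1ℤ else 0ℤ) ℤ.* x else 0ℤ)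
  conj (yes _) (yes _) x = sym (ℤ.*-identityˡ x)
  conj (yes _) (no _)  x = refl
  conj (no _)  _       x = refl
  termwise : ∀ d → 1 ≤ d → d ≤ n → (if does (P? (pred d)) then g (pred d) else 0ℤ) ≡
                                   (if does (d ∣? n) then χ 1 d ℤ.* μ (n ÷ d) else 0ℤ)
  termwise (suc k) _ _ = conj (suc k ∣? n) (suc k % 3 ≟ 1) (g k)

χ-residue : ∀ r x y → x % 3 ≡ y % 3 → χ r x ≡ χ r y
χ-residue r _ _ = cong (λ z → if does (z ≟ r) then 1ℤ else 0ℤ)

*-residue : ∀ p {s} → p % 3 ≡ s → ∀ d → p * d % 3 ≡ s * (d % 3) % 3
*-residue p p≡s d = trans (%-distribˡ-* p d 3) (cong (λ x → x * (d % 3) % 3) p≡s)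

χ-*-≡1 : ∀ p → p % 3 ≡ 1 → ∀ r d → χ r (p * d) ≡ χ r d
χ-*-≡1 p p≡1 r d = χ-residue r (p * d) d (begin
  p * d % 3        ≡⟨ *-residue p p≡1 d ⟩
  1 * (d % 3) % 3  ≡⟨ cong (_% 3) (*-identityˡ (d % 3)) ⟩
  d % 3 % 3        ≡⟨ m%n%n≡m%n d 3 ⟩
  d % 3            ∎)
  where open ≡-Reasoning

χ-*-≡2 : ∀ p → p % 3 ≡ 2 → ∀ d → χ 1 (p * d) ≡ χ 2 d × χ 2 (p * d) ≡ χ 1 d
χ-*-≡2 p p≡2 d = let (χ₁≡χ₂ , χ₂≡χ₁) = swapped (d % 3) (m%n<n d 3) in via χ₁≡χ₂ , via χ₂≡χ₁
  where
  swapped : ∀ x → x < 3 → χ 1 (2 * x) ≡ χ 2 x × χ 2 (2 * x) ≡ χ 1 x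
  swapped 0 _ = refl , refl
  swapped 1 _ = refl , refl
  swapped 2 _ = refl , refl
  swapped (suc (suc (suc _))) (s≤s (s≤s (s≤s ())))
  via : ∀ {r s} → χ r (2 * (d % 3)) ≡ χ s (d % 3) → χ r (p * d) ≡ χ s d
  via {r} {s} eq = trans (χ-residue r (p * d) (2 * (d % 3)) (*-residue p p≡2 d))
                         (trans eq (χ-residue s (d % 3) d (m%n%n≡m%n d 3)))

χ₁-3* : ∀ d → χ 1 (3 * d) ≡ 0ℤ
χ₁-3* d = χ-residue 1 (3 * d) 0 (*-residue 3 refl d)

ω>0 : ∀ {m} → 1 < m → 0 < ω m
ω>0 {m} 1<m with ∃prime∣ 1<m
... | p , p-prime , p∣m = subst (0 <_) (sym (ω≡sumTo m))
  (subst (_≤ ℕΣ.sumTo m _) (if-yes (primeFactor? m p) (p-prime , p∣m))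
    (term≤sumTo m (𝟙 ∘ primeFactor? m) (<⇒≤ (prime⇒>1 p-prime)) (∣⇒≤ {{>-nonZero (<⇒≤ 1<m)}} p∣m)))

signedPowerOf2 : ℕ → ℕ → ℤ
signedPowerOf2 a b = -1ℤ ℤ.^ a ℤ.* (+ 2) ℤ.^ (b ∸ 1)

closedForm : ℕ → ℤ
closedForm m = signedPowerOf2 (Ω m) (ω m)

closedForm-*-∣ : ∀ {p k} .{{_ : NonZero k}} → Prime p → p ∣ k → closedForm (p * k) ≡ ℤ.- closedForm k
closedForm-*-∣ {p} {k} p-prime p∣k = begin
  closedForm (p * k)                           ≡⟨ cong₂ signedPowerOf2 (Ω-* p-prime) (ω-*-∣ p-prime p∣k) ⟩
  -1ℤ ℤ.* -1ℤ ℤ.^ Ω k ℤ.* (+ 2) ℤ.^ (ω k ∸ 1)  ≡⟨ cong (ℤ._* (+ 2) ℤ.^ (ω k ∸ 1)) (ℤ.-1*i≡-i (-1ℤ ℤ.^ Ω k)) ⟩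
  ℤ.- (-1ℤ ℤ.^ Ω k) ℤ.* (+ 2) ℤ.^ (ω k ∸ 1)    ≡⟨ ℤ.neg-distribˡ-* (-1ℤ ℤ.^ Ω k) _ ⟨
  ℤ.- closedForm k                             ∎
  where open ≡-Reasoning

closedForm-*-∤ : ∀ {p k} → Prime p → 1 < k → p ∤ k → closedForm (p * k) ≡ ℤ.- closedForm k ℤ.+ ℤ.- closedForm k
closedForm-*-∤ {p} {k} p-prime 1<k p∤k =
  trans (cong₂ signedPowerOf2 (Ω-* p-prime) (ω-*-∤ p-prime p∤k)) (doubled (Ω k) (ω k) (ω>0 1<k))
  where
  instance
    k≢0 : NonZero k
    k≢0 = >-nonZero (<⇒≤ 1<k)
  identity : ∀ s t → -1ℤ ℤ.* s ℤ.* ((+ 2) ℤ.* t) ≡ ℤ.- (s ℤ.* t) ℤ.+ ℤ.- (s ℤ.* t)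
  identity = solve-∀
  -- 0 < b is needed because b ∸ 1 is truncated subtraction.
  doubled : ∀ a b → 0 < b → signedPowerOf2 (suc a) (suc b) ≡ ℤ.- signedPowerOf2 a b ℤ.+ ℤ.- signedPowerOf2 a b
  doubled a (suc b) _ = identity (-1ℤ ℤ.^ a) ((+ 2) ℤ.^ b)

closedForm-prime : ∀ {p} → Prime p → closedForm p ≡ -1ℤ
closedForm-prime {p} p-prime = subst (λ n → closedForm n ≡ -1ℤ) (*-identityʳ p)
  (cong₂ signedPowerOf2 (Ω-* p-prime) (ω-*-∤ p-prime (prime∤1 p-prime)))

HasClosedForm : ℕ → Set
HasClosedForm m = χ 1 ⋆μ m ≡ closedForm m × χ 2 ⋆μ m ≡ ℤ.- closedForm m

χ⋆μ-prime : ∀ {p} → Prime p → p % 3 ≡ 2 → HasClosedForm p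
χ⋆μ-prime {p} p-prime p≡2 =
  trans χ₁⋆μp≡-1 (sym (closedForm-prime p-prime)) , trans χ₂⋆μp≡1 (cong ℤ.-_ (sym (closedForm-prime p-prime)))
  where
  χ⋆μ[p*1] : χ 1 ⋆μ (p * 1) ≡ -1ℤ × χ 2 ⋆μ (p * 1) ≡ 1ℤ
  χ⋆μ[p*1] =
    trans (⋆μ-*-∤ p-prime (χ 1) 1 (prime∤1 p-prime)) (cong (ℤ._+_ -1ℤ) (⋆μ-cong 1 (proj₁ ∘ χ-*-≡2 p p≡2))) ,
    trans (⋆μ-*-∤ p-prime (χ 2) 1 (prime∤1 p-prime)) (cong (ℤ._+_ 0ℤ) (⋆μ-cong 1 (proj₂ ∘ χ-*-≡2 p p≡2)))
  χ₁⋆μp≡-1 : χ 1 ⋆μ p ≡ -1ℤ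
  χ₁⋆μp≡-1 = subst (λ n → χ 1 ⋆μ n ≡ -1ℤ) (*-identityʳ p) (proj₁ χ⋆μ[p*1])
  χ₂⋆μp≡1 : χ 2 ⋆μ p ≡ 1ℤ
  χ₂⋆μp≡1 = subst (λ n → χ 2 ⋆μ n ≡ 1ℤ) (*-identityʳ p) (proj₂ χ⋆μ[p*1])

χ⋆μ-*-≡2 : ∀ {p k} → Prime p → p % 3 ≡ 2 → 1 < k → HasClosedForm k → HasClosedForm (p * k)
χ⋆μ-*-≡2 {p} {k} p-prime p≡2 1<k (χ₁⋆μk , χ₂⋆μk) = byDivisibility (p ∣? k)
  where
  open ≡-Reasoning
  instance
    k≢0 : NonZero k
    k≢0 = >-nonZero (<⇒≤ 1<k)
  swap₁ : (χ 1 ∘ (p *_)) ⋆μ k ≡ χ 2 ⋆μ k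
  swap₁ = ⋆μ-cong k (proj₁ ∘ χ-*-≡2 p p≡2)
  swap₂ : (χ 2 ∘ (p *_)) ⋆μ k ≡ χ 1 ⋆μ k
  swap₂ = ⋆μ-cong k (proj₂ ∘ χ-*-≡2 p p≡2)
  byDivisibility : Dec (p ∣ k) → HasClosedForm (p * k)
  byDivisibility (yes p∣k) =
    (begin
      χ 1 ⋆μ (p * k)       ≡⟨ ⋆μ-*-∣ p-prime (χ 1) k p∣k ⟩
      (χ 1 ∘ (p *_)) ⋆μ k  ≡⟨ trans swap₁ χ₂⋆μk ⟩
      ℤ.- closedForm k     ≡⟨ closedForm-*-∣ p-prime p∣k ⟨
      closedForm (p * k)   ∎) ,
    (begin
      χ 2 ⋆μ (p * k)          ≡⟨ ⋆μ-*-∣ p-prime (χ 2) k p∣k ⟩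
      (χ 2 ∘ (p *_)) ⋆μ k     ≡⟨ trans swap₂ χ₁⋆μk ⟩
      closedForm k            ≡⟨ ℤ.neg-involutive (closedForm k) ⟨
      ℤ.- ℤ.- closedForm k    ≡⟨ cong ℤ.-_ (closedForm-*-∣ p-prime p∣k) ⟨
      ℤ.- closedForm (p * k)  ∎)
  byDivisibility (no p∤k) =
    (begin
      χ 1 ⋆μ (p * k)                          ≡⟨ ⋆μ-*-∤ p-prime (χ 1) k p∤k ⟩
      ℤ.- (χ 1 ⋆μ k) ℤ.+ (χ 1 ∘ (p *_)) ⋆μ k  ≡⟨ cong₂ (λ x y → ℤ.- x ℤ.+ y) χ₁⋆μk (trans swap₁ χ₂⋆μk) ⟩
      ℤ.- closedForm k ℤ.+ ℤ.- closedForm k   ≡⟨ closedForm-*-∤ p-prime 1<k p∤k ⟨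
      closedForm (p * k)                      ∎) ,
    (begin
      χ 2 ⋆μ (p * k)                                 ≡⟨ ⋆μ-*-∤ p-prime (χ 2) k p∤k ⟩
      ℤ.- (χ 2 ⋆μ k) ℤ.+ (χ 2 ∘ (p *_)) ⋆μ k         ≡⟨ cong₂ (λ x y → ℤ.- x ℤ.+ y) χ₂⋆μk (trans swap₂ χ₁⋆μk) ⟩
      ℤ.- ℤ.- closedForm k ℤ.+ closedForm k          ≡⟨ cong (ℤ._+_ (ℤ.- ℤ.- closedForm k)) (ℤ.neg-involutive (closedForm k)) ⟨
      ℤ.- ℤ.- closedForm k ℤ.+ ℤ.- ℤ.- closedForm k  ≡⟨ ℤ.neg-distrib-+ (ℤ.- closedForm k) (ℤ.- closedForm k) ⟨
      ℤ.- (ℤ.- closedForm k ℤ.+ ℤ.- closedForm k)    ≡⟨ cong ℤ.-_ (closedForm-*-∤ p-prime 1<k p∤k) ⟨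
      ℤ.- closedForm (p * k)                         ∎)

AllPrimeFactors≡2 : ℕ → Set
AllPrimeFactors≡2 m = ∀ {p} → Prime p → p ∣ m → p % 3 ≡ 2

χ⋆μ-closedForm : ∀ m → 1 < m → AllPrimeFactors≡2 m → HasClosedForm m
χ⋆μ-closedForm = prime-*-induction (λ m → AllPrimeFactors≡2 m → HasClosedForm m)
  (λ p-prime ≡2 → χ⋆μ-prime p-prime (≡2 p-prime ∣-refl))
  (λ {p} p-prime 1<k ih ≡2 → χ⋆μ-*-≡2 p-prime (≡2 p-prime (m∣m*n _)) 1<k
                               (ih λ q-prime q∣k → ≡2 q-prime (∣-trans q∣k (n∣m*n p))))

prime3 : Prime 3
prime3 = from-yes (prime? 3)

allPrimeFactors≡2 : ∀ {m} → 3 ∤ m → ¬ (∃[ p ] (Prime p × p % 3 ≡ 1 × p ∣ m)) → AllPrimeFactors≡2 m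
allPrimeFactors≡2 {m} 3∤m no≡1 {p} p-prime p∣m with p % 3 in p%3
... | 0 = ⊥-elim (3∤m (subst (_∣ m) (sym (prime∣prime⇒≡ prime3 p-prime (m%n≡0⇒n∣m p 3 p%3))) p∣m))
... | 1 = ⊥-elim (no≡1 (p , p-prime , p%3 , p∣m))
... | 2 = refl
... | suc (suc (suc _)) = ⊥-elim (<⇒≱ (m%n<n p 3) (subst (3 ≤_) (sym p%3) (s≤s (s≤s (s≤s z≤n)))))

J-3^b*m-b≤1 : ∀ b m .{{_ : NonZero m}} → 3 ∤ m → b ≤ 1 → J (3 ^ b * m) ≡ -1ℤ ℤ.^ b ℤ.* χ 1 ⋆μ m
J-3^b*m-b≤1 0 m 3∤m _ = begin
  J (1 * m)        ≡⟨ cong J (*-identityˡ m) ⟩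
  J m              ≡⟨ J≡χ₁⋆μ m ⟩
  χ 1 ⋆μ m         ≡⟨ ℤ.*-identityˡ (χ 1 ⋆μ m) ⟨
  1ℤ ℤ.* χ 1 ⋆μ m  ∎
  where open ≡-Reasoning
J-3^b*m-b≤1 1 m 3∤m _ = begin
  J (3 * m)                                    ≡⟨ J≡χ₁⋆μ (3 * m) ⟩
  χ 1 ⋆μ (3 * m)                               ≡⟨ ⋆μ-*-∤ prime3 (χ 1) m 3∤m ⟩
  ℤ.- (χ 1 ⋆μ m) ℤ.+ (λ d → χ 1 (3 * d)) ⋆μ m  ≡⟨ cong (ℤ._+_ (ℤ.- (χ 1 ⋆μ m))) (⋆μ-zero m χ₁-3*) ⟩
  ℤ.- (χ 1 ⋆μ m) ℤ.+ 0ℤ                        ≡⟨ ℤ.+-identityʳ _ ⟩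
  ℤ.- (χ 1 ⋆μ m)                               ≡⟨ ℤ.-1*i≡-i (χ 1 ⋆μ m) ⟨
  -1ℤ ℤ.* χ 1 ⋆μ m                             ∎
  where open ≡-Reasoning
J-3^b*m-b≤1 (suc (suc _)) m _ (s≤s ())

J-3^b*m-2≤b : ∀ b m .{{_ : NonZero m}} → 2 ≤ b → J (3 ^ b * m) ≡ 0ℤ
J-3^b*m-2≤b (suc zero)    m (s≤s ())
J-3^b*m-2≤b (suc (suc b)) m _ = begin
  J (3 ^ suc (suc b) * m)   ≡⟨ cong J (*-assoc 3 (3 ^ suc b) m) ⟩
  J (3 * x)                 ≡⟨ J≡χ₁⋆μ (3 * x) ⟩
  χ 1 ⋆μ (3 * x)            ≡⟨ ⋆μ-*-∣ prime3 (χ 1) x (∣-trans (m∣m*n (3 ^ b)) (m∣m*n m)) ⟩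
  (λ d → χ 1 (3 * d)) ⋆μ x  ≡⟨ ⋆μ-zero x χ₁-3* ⟩
  0ℤ                        ∎
  where
  open ≡-Reasoning
  x : ℕ
  x = 3 ^ suc b * m
  instance
    x≢0 : NonZero x
    x≢0 = m*n≢0 (3 ^ suc b) m {{m^n≢0 3 (suc b)}}

J-3^b*m-vanishes : ∀ {p} b m .{{_ : NonZero m}} → 3 ∤ m → Prime p → p % 3 ≡ 1 → p ∣ m → J (3 ^ b * m) ≡ 0ℤ
J-3^b*m-vanishes {p} b m 3∤m p-prime p≡1 p∣m with b ≤? 1
... | no  b≰1 = J-3^b*m-2≤b b m (≰⇒> b≰1)
... | yes b≤1 = begin
  J (3 ^ b * m)           ≡⟨ J-3^b*m-b≤1 b m 3∤m b≤1 ⟩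
  -1ℤ ℤ.^ b ℤ.* χ 1 ⋆μ m  ≡⟨ cong (-1ℤ ℤ.^ b ℤ.*_) (⋆μ-vanish (χ 1) p-prime (χ-*-≡1 p p≡1 1) p∣m) ⟩
  -1ℤ ℤ.^ b ℤ.* 0ℤ        ≡⟨ ℤ.*-zeroʳ (-1ℤ ℤ.^ b) ⟩
  0ℤ                      ∎
  where open ≡-Reasoning

J-3^b*m-closedForm : ∀ b m .{{_ : NonZero m}} → 3 ∤ m → b ≤ 1 → 1 < m → AllPrimeFactors≡2 m →
                     J (3 ^ b * m) ≡ signedPowerOf2 (Ω (3 ^ b * m)) (ω m)
J-3^b*m-closedForm b m 3∤m b≤1 1<m ≡2 = begin
  J (3 ^ b * m)                                      ≡⟨ J-3^b*m-b≤1 b m 3∤m b≤1 ⟩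
  -1ℤ ℤ.^ b ℤ.* χ 1 ⋆μ m                             ≡⟨ cong (-1ℤ ℤ.^ b ℤ.*_) (proj₁ (χ⋆μ-closedForm m 1<m ≡2)) ⟩
  -1ℤ ℤ.^ b ℤ.* closedForm m                         ≡⟨ ℤ.*-assoc (-1ℤ ℤ.^ b) (-1ℤ ℤ.^ Ω m) ((+ 2) ℤ.^ (ω m ∸ 1)) ⟨
  -1ℤ ℤ.^ b ℤ.* -1ℤ ℤ.^ Ω m ℤ.* (+ 2) ℤ.^ (ω m ∸ 1)  ≡⟨ cong (ℤ._* (+ 2) ℤ.^ (ω m ∸ 1)) (ℤ.^-distribˡ-+-* -1ℤ b (Ω m)) ⟨
  signedPowerOf2 (b + Ω m) (ω m)                     ≡⟨ cong (λ a → signedPowerOf2 a (ω m)) (Ω-^* prime3 b m) ⟨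
  signedPowerOf2 (Ω (3 ^ b * m)) (ω m)               ∎
  where open ≡-Reasoning

cofactor>1 : ∀ {b m} .{{_ : NonZero m}} → b ≤ 1 → 3 ^ b * m ≢ 1 → 3 ^ b * m ≢ 3 → 1 < m
cofactor>1 {m = suc (suc _)} _        _  _  = s≤s (s≤s z≤n)
cofactor>1 {0}           {1} _        ≢1 _  = ⊥-elim (≢1 refl)
cofactor>1 {1}           {1} _        _  ≢3 = ⊥-elim (≢3 refl)
cofactor>1 {suc (suc _)} {1} (s≤s ()) _  _

lemma6p1 : (n b m₁ : ℕ) → n ≡ 3 ^ b * m₁ → ¬ (3 ∣ m₁) →
    (n ≡ 1 → J n ≡ + 1)
    × (n ≡ 3 → J n ≡ -[1+ 0 ])
    × ((∃[ p ] (Prime p × p % 3 ≡ 1 × p ∣ m₁)) → J n ≡ + 0)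
    × (2 ≤ b → J n ≡ + 0)
    × (n ≢ 1 → n ≢ 3 → ¬ (∃[ p ] (Prime p × p % 3 ≡ 1 × p ∣ m₁)) → b ≤ 1 →
        J n ≡ ((-[1+ 0 ]) ℤ.^ Ω n) ℤ.* ((+ 2) ℤ.^ (ω m₁ ∸ 1)))
lemma6p1 n b zero       _    3∤0 = ⊥-elim (3∤0 (3 ∣0))
lemma6p1 n b m₁@(suc _) refl 3∤m₁ =
    cong J    -- J 1 and J 3 evaluate to + 1 and -[1+ 0 ]
  , cong J
  , (λ (p , p-prime , p≡1 , p∣m₁) → J-3^b*m-vanishes b m₁ 3∤m₁ p-prime p≡1 p∣m₁)
  , J-3^b*m-2≤b b m₁
  , λ n≢1 n≢3 no≡1 b≤1 →
      J-3^b*m-closedForm b m₁ 3∤m₁ b≤1 (cofactor>1 b≤1 n≢1 n≢3) (allPrimeFactors≡2 3∤m₁ no≡1)
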